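{- Let $G$ be a finite simple graph. Then (1) $\gamma_{\rm gr}^Z(G)\le \operatorname{mr}(G)$; (2) $\gamma_{\rm gr}(G)\le \operatorname{mr}_{\dot\ell}(G)$; (3) $\gamma_{\rm gr}^t(G)\le \operatorname{mr}_0(G)$.
   Context: Let $G$ have vertex set $\{1,\ldots,n\}$. $\mathcal S(G)$ is the set of real symmetric $n\times n$ matrices whose $(i,j)$-entry for $i\ne j$ is nonzero iff $\{i,j\}\in E(G)$ (diagonal unrestricted); $\mathcal S_{\dot\ell}(G)$ is the subset with all diagonal entries nonzero and $\mathcal S_0(G)$ the subset with all diagonal entries zero. $\operatorname{mr}(G),\operatorname{mr}_{\dot\ell}(G),\operatorname{mr}_0(G)$ are the minimum ranks over $\mathcal S(G),\mathcal S_{\dot\ell}(G),\mathcal S_0(G)$ respectively. With $N(x)$, $N[x]$ the open and closed neighborhoods, a sequence $(v_1,\ldots,v_k)$ of distinct vertices is a $Z$-sequence if $N(v_i)\setminus\bigcup_{j<i}N[v_j]\ne\emptyset$ for all $i$; a dominating sequence if $N[v_i]\setminus\bigcup_{j<i}N[v_j]\ne\emptyset$ for all $i$; a total dominating sequence if $N(v_i)\setminus\bigcup_{j<i}N(v_j)\ne\emptyset$ for all $i$. $\gamma_{\rm gr}^Z(G),\gamma_{\rm gr}(G),\gamma_{\rm gr}^t(G)$ are the maximum lengths of such sequences respectively. -}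

module Defs where

open import Level using (Level; _⊔_) renaming (suc to lsuc)
open import Data.Nat using (ℕ; zero; suc; _≤_)
open import Data.Bool using (Bool; true; false; T)
open import Data.Fin using (Fin; zero; suc)
open import Data.List using (List; []; _∷_; length)
open import Data.List.Relation.Unary.All using (All)
open import Data.List.Relation.Unary.Unique.Propositional using (Unique)
open import Data.Product using (Σ; _×_; ∃; ∃-syntax; _,_)
open import Data.Sum using (_⊎_)
open import Relation.Binary.PropositionalEquality using (_≡_; _≢_)
open import Relation.Nullary using (¬_)
open import Function.Bundles using (_⇔_)
open import Algebra.Bundles using (CommutativeRing)

record Field (c ℓ : Level) : Set (lsuc (c ⊔ ℓ)) where
  field
    commRing : CommutativeRing c ℓ
  open CommutativeRing commRing public
  field
    0≉1     : ¬ (0# ≈ 1#)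
    inverse : ∀ x → ¬ (x ≈ 0#) → ∃[ y ] (x * y ≈ 1#)

record Graph (n : ℕ) : Set where
  field
    adj     : Fin n → Fin n → Bool
    sym     : ∀ i j → adj i j ≡ adj j i
    irrefl  : ∀ i → adj i i ≡ false

open Graph public

module _ {n : ℕ} (G : Graph n) where

  InOpen : Fin n → Fin n → Set
  InOpen v u = T (adj G v u)

  InClosed : Fin n → Fin n → Set
  InClosed v u = (u ≡ v) ⊎ InOpen v u

  -- The first argument is the list of
  -- earlier vertices v_1..v_{i-1} (in any order), the second the
  -- remaining sequence.
  ZFrom : List (Fin n) → List (Fin n) → Set
  ZFrom prev []       = Data.Unit.⊤
    where import Data.Unit
  ZFrom prev (v ∷ vs) =
    (∃[ u ] (InOpen v u × All (λ w → ¬ InClosed w u) prev)) × ZFrom (v ∷ prev) vs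

  DomFrom : List (Fin n) → List (Fin n) → Set
  DomFrom prev []       = Data.Unit.⊤
    where import Data.Unit
  DomFrom prev (v ∷ vs) =
    (∃[ u ] (InClosed v u × All (λ w → ¬ InClosed w u) prev)) × DomFrom (v ∷ prev) vs

  TotFrom : List (Fin n) → List (Fin n) → Set
  TotFrom prev []       = Data.Unit.⊤
    where import Data.Unit
  TotFrom prev (v ∷ vs) =
    (∃[ u ] (InOpen v u × All (λ w → ¬ InOpen w u) prev)) × TotFrom (v ∷ prev) vs

  IsZSequence : List (Fin n) → Set
  IsZSequence s = Unique s × ZFrom [] s

  IsDominatingSequence : List (Fin n) → Set
  IsDominatingSequence s = Unique s × DomFrom [] s

  IsTotalDominatingSequence : List (Fin n) → Set
  IsTotalDominatingSequence s = Unique s × TotFrom [] s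

module _ {c ℓ : Level} (F : Field c ℓ) where
  open Field F using (Carrier; _≈_; _+_; _*_; 0#)

  Matrix : ℕ → ℕ → Set c
  Matrix m k = Fin m → Fin k → Carrier

  Σ-sum : ∀ {k} → (Fin k → Carrier) → Carrier
  Σ-sum {zero}  f = 0#
  Σ-sum {suc k} f = f zero + Σ-sum (λ i → f (suc i))

  _⊗_ : ∀ {m k p} → Matrix m k → Matrix k p → Matrix m p
  (B ⊗ C) i j = Σ-sum (λ t → B i t * C t j)

  RankAtMost : ∀ {m p} → Matrix m p → ℕ → Set (c ⊔ ℓ)
  RankAtMost {m} {p} A r =
    ∃[ B ] ∃[ C ] (∀ i j → A i j ≈ (_⊗_ {m} {r} {p} B C) i j)

  module _ {n : ℕ} (G : Graph n) where

    InS : Matrix n n → Set ℓ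
    InS A = (∀ i j → A i j ≈ A j i)
          × (∀ i j → i ≢ j → ((¬ (A i j ≈ 0#)) ⇔ T (adj G i j)))

    InSℓ : Matrix n n → Set ℓ
    InSℓ A = InS A × (∀ i → ¬ (A i i ≈ 0#))

    InS0 : Matrix n n → Set ℓ
    InS0 A = InS A × (∀ i → A i i ≈ 0#)

module Submission where

-- Let A = B C with B of size m×r and C of size r×p, so that the
-- entry A u v is the inner product of the row vector B u with the column
-- vector C · v in F^r.  Each of the three kinds of graph sequences
-- (v_1, …, v_k) comes with witnesses u_1, …, u_k such that A u_i v_i ≠ 0
-- and A u_i v_j = 0 for j < i: the k×k submatrix on these rows and
-- columns is triangular with nonzero diagonal, hence k ≤ rank A ≤ r.
--
-- Equality in F is not assumed decidable, so "A u w = 0" is only available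
-- up to double negation; as every argument ends in a contradiction, this
-- suffices.

open import Defs
open import Level using (Level; _⊔_)
open import Data.Nat using (ℕ; zero; suc; _≤_; _<_; s≤s)
open import Data.Nat.Properties using (≮⇒≥)
open import Data.Fin using (Fin; zero; suc; _≟_)
open import Data.Vec.Functional using (Vector; removeAt)
open import Data.List using (List; []; _∷_; length; map)
open import Data.List.Properties using (length-map)
open import Data.List.Relation.Unary.All as All using (All; []; _∷_)
open import Data.List.Relation.Unary.All.Properties using (map⁺)
open import Data.Unit.Polymorphic using (⊤; tt)
open import Data.Product using (_×_; _,_; ∃; ∃-syntax; proj₁; proj₂)
open import Data.Sum using (inj₁; inj₂)
open import Data.Bool using (T)
open import Relation.Nullary using (¬_; yes; no)
open import Function.Bundles using (Equivalence; _⇔_)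
open import Relation.Nullary.Negation.Core using (DoubleNegation)
open import Relation.Binary.PropositionalEquality as ≡ using (_≡_; _≢_)

module LinearAlgebra {c ℓ : Level} (F : Field c ℓ) where
  open Field F
    using (Carrier; _≈_; _+_; _*_; -_; 0#; 1#; inverse; setoid; semiring; ring
          ; *-commutativeSemigroup; +-cong; +-congˡ; *-congˡ; *-assoc
          ; *-comm; *-identityʳ; distribˡ; zeroʳ; +-identityˡ; +-identityʳ
          ; -‿cong; -‿inverseʳ)
    renaming (refl to ≈-refl; sym to ≈-sym; trans to ≈-trans)
  open import Algebra.Properties.Semiring.Sum semiring
    using (sum; sum-cong-≋; sum-remove; ∑-distrib-+; *-distribˡ-sum)
  open import Algebra.Properties.Ring ring using (-‿distribˡ-*)
  open import Algebra.Properties.CommutativeSemigroup *-commutativeSemigroup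
    using (x∙yz≈y∙xz)
  open import Relation.Binary.Reasoning.Setoid setoid

  Vanishes : Carrier → Set ℓ
  Vanishes x = DoubleNegation (x ≈ 0#)

  Σ-sum≡sum : ∀ {k} (f : Vector Carrier k) → Σ-sum F f ≡ sum f
  Σ-sum≡sum {zero}  f = ≡.refl
  Σ-sum≡sum {suc k} f = ≡.cong (f zero +_) (Σ-sum≡sum (λ i → f (suc i)))

  ⟨_,_⟩ : ∀ {r} → Vector Carrier r → Vector Carrier r → Carrier
  ⟨ p , q ⟩ = sum (λ s → p s * q s)

  product-entry : ∀ {m r p} (B : Matrix F m r) (C : Matrix F r p) i j →
                  _⊗_ F B C i j ≡ ⟨ B i , (λ t → C t j) ⟩
  product-entry B C i j = Σ-sum≡sum (λ t → B i t * C t j)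

  sum-nonzero : ∀ {k} (f : Vector Carrier k) → ¬ (sum f ≈ 0#) →
                DoubleNegation (∃ λ t → ¬ (f t ≈ 0#))
  sum-nonzero {zero}  f sum≉0 _        = sum≉0 ≈-refl
  sum-nonzero {suc k} f sum≉0 no-witness =
    sum-nonzero (λ t → f (suc t)) tail≉0 (λ { (t , ft≉0) → no-witness (suc t , ft≉0) })
    where
    tail≉0 : ¬ (sum (λ t → f (suc t)) ≈ 0#)
    tail≉0 tail≈0 = no-witness (zero , λ f0≈0 →
      sum≉0 (≈-trans (+-cong f0≈0 tail≈0) (+-identityˡ 0#)))

  ⟨⟩-linear : ∀ {r} (p q q′ : Vector Carrier r) a →
              ⟨ p , (λ s → q′ s + a * q s) ⟩ ≈ ⟨ p , q′ ⟩ + a * ⟨ p , q ⟩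
  ⟨⟩-linear p q q′ a = begin
    sum (λ s → p s * (q′ s + a * q s))
      ≈⟨ sum-cong-≋ (λ s → ≈-trans (distribˡ (p s) (q′ s) (a * q s))
                                   (+-congˡ (x∙yz≈y∙xz (p s) a (q s)))) ⟩
    sum (λ s → p s * q′ s + a * (p s * q s))
      ≈⟨ ∑-distrib-+ (λ s → p s * q′ s) (λ s → a * (p s * q s)) ⟩
    ⟨ p , q′ ⟩ + sum (λ s → a * (p s * q s))
      ≈⟨ +-congˡ (≈-sym (*-distribˡ-sum a (λ s → p s * q s))) ⟩
    ⟨ p , q′ ⟩ + a * ⟨ p , q ⟩ ∎

  ⟨⟩-remove : ∀ {r} (p q : Vector Carrier (suc r)) t →
              ⟨ p , q ⟩ ≈ p t * q t + ⟨ removeAt p t , removeAt q t ⟩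
  ⟨⟩-remove p q t = sum-remove {i = t} (λ s → p s * q s)

  Triangular : ∀ {r} → List (Vector Carrier r × Vector Carrier r) → Set (c ⊔ ℓ)
  Triangular []             = ⊤
  Triangular ((p , q) ∷ xs) =
    ¬ (⟨ p , q ⟩ ≈ 0#) × All (λ x → Vanishes ⟨ proj₁ x , q ⟩) xs × Triangular xs

  -- Clearing
  -- coordinate t of any q′ by subtracting a multiple of q and then deleting
  -- coordinate t preserves inner products with every p orthogonal to q.
  module Pivot {r} (q : Vector Carrier (suc r)) (t : Fin (suc r)) (qt≉0 : ¬ (q t ≈ 0#)) where

    q⁻¹ : Carrier
    q⁻¹ = proj₁ (inverse (q t) qt≉0)

    q*q⁻¹≈1 : q t * q⁻¹ ≈ 1#
    q*q⁻¹≈1 = proj₂ (inverse (q t) qt≉0)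

    factor : Vector Carrier (suc r) → Carrier
    factor q′ = - (q′ t * q⁻¹)

    clear : Vector Carrier (suc r) → Vector Carrier (suc r)
    clear q′ s = q′ s + factor q′ * q s

    clear-pivot : ∀ q′ → clear q′ t ≈ 0#
    clear-pivot q′ = begin
      q′ t + - (q′ t * q⁻¹) * q t   ≈⟨ +-congˡ (≈-sym (-‿distribˡ-* (q′ t * q⁻¹) (q t))) ⟩
      q′ t + - (q′ t * q⁻¹ * q t)   ≈⟨ +-congˡ (-‿cong (*-assoc (q′ t) q⁻¹ (q t))) ⟩
      q′ t + - (q′ t * (q⁻¹ * q t)) ≈⟨ +-congˡ (-‿cong (*-congˡ (≈-trans (*-comm q⁻¹ (q t)) q*q⁻¹≈1))) ⟩
      q′ t + - (q′ t * 1#)          ≈⟨ +-congˡ (-‿cong (*-identityʳ (q′ t))) ⟩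
      q′ t + - q′ t                 ≈⟨ -‿inverseʳ (q′ t) ⟩
      0# ∎

    reduce : Vector Carrier (suc r) → Vector Carrier r
    reduce q′ = removeAt (clear q′) t

    reduce-preserves : ∀ p q′ → ⟨ p , q ⟩ ≈ 0# → ⟨ removeAt p t , reduce q′ ⟩ ≈ ⟨ p , q′ ⟩
    reduce-preserves p q′ p⊥q = begin
      ⟨ removeAt p t , reduce q′ ⟩                 ≈⟨ ≈-sym (+-identityˡ _) ⟩
      0# + ⟨ removeAt p t , reduce q′ ⟩            ≈⟨ +-cong (≈-sym (≈-trans (*-congˡ (clear-pivot q′)) (zeroʳ (p t)))) ≈-refl ⟩
      p t * clear q′ t + ⟨ removeAt p t , reduce q′ ⟩ ≈⟨ ≈-sym (⟨⟩-remove p (clear q′) t) ⟩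
      ⟨ p , clear q′ ⟩                             ≈⟨ ⟨⟩-linear p q q′ (factor q′) ⟩
      ⟨ p , q′ ⟩ + factor q′ * ⟨ p , q ⟩           ≈⟨ +-congˡ (≈-trans (*-congˡ p⊥q) (zeroʳ (factor q′))) ⟩
      ⟨ p , q′ ⟩ + 0#                              ≈⟨ +-identityʳ _ ⟩
      ⟨ p , q′ ⟩ ∎

    reduce-pair : Vector Carrier (suc r) × Vector Carrier (suc r) → Vector Carrier r × Vector Carrier r
    reduce-pair (p′ , q′) = removeAt p′ t , reduce q′

    reduce-nonzero : ∀ p′ q′ → Vanishes ⟨ p′ , q ⟩ → ¬ (⟨ p′ , q′ ⟩ ≈ 0#) →
                     ¬ (⟨ removeAt p′ t , reduce q′ ⟩ ≈ 0#)
    reduce-nonzero p′ q′ p′⊥q ⟨p′,q′⟩≉0 reduced≈0 =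
      p′⊥q (λ ⟨p′,q⟩≈0 →
        ⟨p′,q′⟩≉0 (≈-trans (≈-sym (reduce-preserves p′ q′ ⟨p′,q⟩≈0)) reduced≈0))

    reduce-vanishes : ∀ p′ q′ → Vanishes ⟨ p′ , q ⟩ → Vanishes ⟨ p′ , q′ ⟩ →
                      Vanishes ⟨ removeAt p′ t , reduce q′ ⟩
    reduce-vanishes p′ q′ p′⊥q p′⊥q′ reduced≉0 =
      p′⊥q (λ ⟨p′,q⟩≈0 → p′⊥q′ (λ ⟨p′,q′⟩≈0 →
        reduced≉0 (≈-trans (reduce-preserves p′ q′ ⟨p′,q⟩≈0) ⟨p′,q′⟩≈0)))

    reduce-triangular : ∀ xs → All (λ x → Vanishes ⟨ proj₁ x , q ⟩) xs → Triangular xs →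
                        Triangular (map reduce-pair xs)
    reduce-triangular []               []             _ = tt
    reduce-triangular ((p′ , q′) ∷ ys) (p′⊥q ∷ ys⊥q) (⟨p′,q′⟩≉0 , ys⊥q′ , ys-triangular) =
      reduce-nonzero p′ q′ p′⊥q ⟨p′,q′⟩≉0 ,
      map⁺ (All.zipWith (λ { {p″ , _} (p″⊥q , p″⊥q′) → reduce-vanishes p″ q′ p″⊥q p″⊥q′ })
                        (ys⊥q , ys⊥q′)) ,
      reduce-triangular ys ys⊥q ys-triangular

  -- Some coordinate t of q_1 is nonzero since ⟨p_1,q_1⟩ ≠ 0;
  -- eliminating it turns the remaining k - 1 pairs into a triangular
  -- family in F^(r-1).
  triangular-bound : ∀ r (xs : List (Vector Carrier r × Vector Carrier r)) →
                     Triangular xs → ¬ (r < length xs)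
  triangular-bound zero    ((p , q) ∷ xs) (⟨p,q⟩≉0 , _) _ = ⟨p,q⟩≉0 ≈-refl
  triangular-bound (suc r) ((p , q) ∷ xs) (⟨p,q⟩≉0 , xs⊥q , xs-triangular) (s≤s r<k) =
    sum-nonzero (λ s → p s * q s) ⟨p,q⟩≉0 eliminate
    where
    eliminate : ¬ ∃ λ t → ¬ (p t * q t ≈ 0#)
    eliminate (t , ptqt≉0) =
      triangular-bound r (map reduce-pair xs) (reduce-triangular xs xs⊥q xs-triangular)
        (≡.subst (r <_) (≡.sym (length-map reduce-pair xs)) r<k)
      where
      qt≉0 : ¬ (q t ≈ 0#)
      qt≉0 qt≈0 = ptqt≉0 (≈-trans (*-congˡ qt≈0) (zeroʳ (p t)))

      open Pivot q t qt≉0 using (reduce-pair; reduce-triangular)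

-- The first argument lists the earlier columns.
module Staircases {c ℓ : Level} (F : Field c ℓ) {m p : ℕ} (A : Matrix F m p) where
  open Field F using (Carrier; _≈_; 0#) renaming (sym to ≈-sym; trans to ≈-trans; reflexive to ≈-reflexive)
  open LinearAlgebra F using (Vanishes; ⟨_,_⟩; product-entry; Triangular; triangular-bound)

  StaircaseFrom : List (Fin p) → List (Fin p) → Set ℓ
  StaircaseFrom prev []       = ⊤
  StaircaseFrom prev (v ∷ vs) =
    (∃[ u ] (¬ (A u v ≈ 0#) × All (λ w → Vanishes (A u w)) prev)) × StaircaseFrom (v ∷ prev) vs

  module _ {r : ℕ} (B : Matrix F m r) (C : Matrix F r p) (A≈BC : ∀ i j → A i j ≈ _⊗_ F B C i j) where

    column : Fin p → Vector Carrier r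
    column v t = C t v

    entry : ∀ u v → A u v ≈ ⟨ B u , column v ⟩
    entry u v = ≈-trans (A≈BC u v) (≈-reflexive (product-entry B C u v))

    entry-nonzero : ∀ u v → ¬ (A u v ≈ 0#) → ¬ (⟨ B u , column v ⟩ ≈ 0#)
    entry-nonzero u v Auv≉0 ⟨Bu,v⟩≈0 = Auv≉0 (≈-trans (entry u v) ⟨Bu,v⟩≈0)

    entry-vanishes : ∀ u w → Vanishes (A u w) → Vanishes ⟨ B u , column w ⟩
    entry-vanishes u w Auw-vanishes ⟨Bu,w⟩≉0 =
      Auw-vanishes (λ Auw≈0 → ⟨Bu,w⟩≉0 (≈-trans (≈-sym (entry u w)) Auw≈0))

    -- The pairs (B u_i, column v_i) of a staircase form a triangular family;
    -- the invariant records that each row vector is orthogonal to the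
    -- columns already passed.
    staircase-triangular : ∀ prev s → StaircaseFrom prev s →
      ∃[ xs ] (length xs ≡ length s × Triangular xs
               × All (λ x → All (λ w → Vanishes ⟨ proj₁ x , column w ⟩) prev) xs)
    staircase-triangular prev []       _ = [] , ≡.refl , tt , []
    staircase-triangular prev (v ∷ vs) ((u , Auv≉0 , prev-vanish) , rest) =
      let xs , length-xs , xs-triangular , xs⊥ = staircase-triangular (v ∷ prev) vs rest
      in (B u , column v) ∷ xs , ≡.cong suc length-xs ,
         (entry-nonzero u v Auv≉0 , All.map All.head xs⊥ , xs-triangular) ,
         All.map (entry-vanishes u _) prev-vanish ∷ All.map All.tail xs⊥

  staircase-bound : ∀ {r} → RankAtMost F A r → ∀ s → StaircaseFrom [] s → length s ≤ r
  staircase-bound {r} (B , C , A≈BC) s staircase =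
    let xs , length-xs , xs-triangular , _ = staircase-triangular B C A≈BC [] s staircase
    in ≡.subst (_≤ r) length-xs (≮⇒≥ (triangular-bound r xs xs-triangular))

-- For w ≠ u, A u w ≠ 0 exactly when u ∼ w, so edges give
-- nonzero entries and non-edges vanishing ones; the diagonal is handled
-- by the extra hypotheses of S_ℓ̇(G) and S_0(G).
module GraphSequences {c ℓ : Level} (F : Field c ℓ) {n : ℕ} (G : Graph n)
                      (A : Matrix F n n) (A∈S : InS F G A) where
  open Field F using (_≈_; 0#)
  open LinearAlgebra F using (Vanishes)
  open Staircases F A using (StaircaseFrom)

  support : ∀ i j → i ≢ j → (¬ (A i j ≈ 0#)) ⇔ T (adj G i j)
  support = proj₂ A∈S

  edge-nonzero : ∀ v u → InOpen G v u → ¬ (A u v ≈ 0#)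
  edge-nonzero v u v∼u = Equivalence.from (support u v u≢v) (≡.subst T (Graph.sym G v u) v∼u)
    where
    u≢v : u ≢ v
    u≢v ≡.refl = ≡.subst T (irrefl G v) v∼u

  nonneighbour-vanishes : ∀ w u → ¬ InClosed G w u → Vanishes (A u w)
  nonneighbour-vanishes w u u∉N[w] Auw≉0 =
    u∉N[w] (inj₂ (≡.subst T (Graph.sym G u w) (Equivalence.to (support u w u≢w) Auw≉0)))
    where
    u≢w : u ≢ w
    u≢w u≡w = u∉N[w] (inj₁ u≡w)

  Z-staircase : ∀ prev s → ZFrom G prev s → StaircaseFrom prev s
  Z-staircase prev []       _ = tt
  Z-staircase prev (v ∷ vs) ((u , v∼u , prev-far) , rest) =
    (u , edge-nonzero v u v∼u , All.map (λ {w} → nonneighbour-vanishes w u) prev-far) ,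
    Z-staircase (v ∷ prev) vs rest

  -- Dominating sequences: u_i ∈ N[v_i], so the diagonal must be nonzero.
  dominating-staircase : (∀ i → ¬ (A i i ≈ 0#)) → ∀ prev s → DomFrom G prev s → StaircaseFrom prev s
  dominating-staircase diag≉0 prev []       _ = tt
  dominating-staircase diag≉0 prev (v ∷ vs) ((u , u∈N[v] , prev-far) , rest) =
    (u , closed-nonzero u∈N[v] , All.map (λ {w} → nonneighbour-vanishes w u) prev-far) ,
    dominating-staircase diag≉0 (v ∷ prev) vs rest
    where
    closed-nonzero : InClosed G v u → ¬ (A u v ≈ 0#)
    closed-nonzero (inj₁ ≡.refl) = diag≉0 u
    closed-nonzero (inj₂ v∼u)    = edge-nonzero v u v∼u

  -- Total dominating sequences: u_i ∉ N(v_j) allows u_i = v_j, so the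
  -- diagonal must vanish.
  total-staircase : (∀ i → A i i ≈ 0#) → ∀ prev s → TotFrom G prev s → StaircaseFrom prev s
  total-staircase diag≈0 prev []       _ = tt
  total-staircase diag≈0 prev (v ∷ vs) ((u , v∼u , prev-far) , rest) =
    (u , edge-nonzero v u v∼u , All.map (λ {w} → nonedge-vanishes w) prev-far) ,
    total-staircase diag≈0 (v ∷ prev) vs rest
    where
    nonedge-vanishes : ∀ w → ¬ InOpen G w u → Vanishes (A u w)
    nonedge-vanishes w w≁u Auw≉0 with u ≟ w
    ... | yes ≡.refl = Auw≉0 (diag≈0 u)
    ... | no u≢w     = w≁u (≡.subst T (Graph.sym G u w) (Equivalence.to (support u w u≢w) Auw≉0))

-- Theorem 3.1.
theorem3p1 : ∀ {c ℓ : Level} (F : Field c ℓ) (n : ℕ) (G : Graph n) →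
  (∀ (s : List (Fin n)) (A : Matrix F n n) (r : ℕ) →
    IsZSequence G s → InS F G A → RankAtMost F A r → length s ≤ r)
  × (∀ (s : List (Fin n)) (A : Matrix F n n) (r : ℕ) →
    IsDominatingSequence G s → InSℓ F G A → RankAtMost F A r → length s ≤ r)
  × (∀ (s : List (Fin n)) (A : Matrix F n n) (r : ℕ) →
    IsTotalDominatingSequence G s → InS0 F G A → RankAtMost F A r → length s ≤ r)
theorem3p1 F n G =
  (λ s A _ (_ , Z-seq) A∈S rank →
     staircase-bound F A rank s (Z-staircase F G A A∈S [] s Z-seq)) ,
  (λ s A _ (_ , dom-seq) (A∈S , diag≉0) rank →
     staircase-bound F A rank s (dominating-staircase F G A A∈S diag≉0 [] s dom-seq)) ,
  (λ s A _ (_ , tot-seq) (A∈S , diag≈0) rank →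
     staircase-bound F A rank s (total-staircase F G A A∈S diag≈0 [] s tot-seq))
  where
  open Staircases using (staircase-bound)
  open GraphSequences using (Z-staircase; dominating-staircase; total-staircase)
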